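{- Let $t$ and $s$ be well-formed suspension terms (containing no meta variables) such that $t\rhd_{\beta_s} s$. Then $\|t\|\rhd_\beta^*\|s\|$.
   Context: Suspension calculus without meta variables. Terms $t ::= c \mid \#i \mid (t\ t)\mid(\lambda\, t)\mid [\![t,n,n,e]\!]$, environments $e::= nil\mid ((t,n)::e)\mid \{\!\{e,n,n,e\}\!\}$ ($c$ constants, $n$ naturals, $i$ positive integers). $m\mathbin{\dot- } n=\max(m-n,0)$. Length: $len(nil)=0$, $len((t,l)::e)=1+len(e)$, $len(\{\!\{e_1,nl_1,ol_2,e_2\}\!\})=len(e_1)+(len(e_2)\mathbin{\dot- } nl_1)$. Level: $lev(nil)=0$, $lev((t,l)::e)=l$, $lev(\{\!\{e_1,nl_1,ol_2,e_2\}\!\})=lev(e_2)+(nl_1\mathbin{\dot- } ol_2)$. Well-formed: every subexpression satisfies: $[\![t,ol,nl,e]\!]$ has $len(e)=ol$, $lev(e)\le nl$; $(t,l)::e$ has $l\ge lev(e)$; $\{\!\{e_1,nl_1,ol_2,e_2\}\!\}$ has $lev(e_1)\le nl_1$, $len(e_2)=ol_2$. Rules: $(\beta_s)$ $((\lambda t_1)\ t_2)\to[\![t_1,1,0,(t_2,0)::nil]\!]$; reading rules (r1) $[\![c,ol,nl,e]\!]\to c$; (r2) $[\![\#i,0,nl,nil]\!]\to\#(i+nl)$; (r3) $[\![\#1,ol,nl,(t,l)::e]\!]\to[\![t,0,nl-l,nil]\!]$; (r4) $[\![\#i,ol,nl,(t,l)::e]\!]\to[\![\#(i-1),ol-1,nl,e]\!]$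 if $i>1$; (r5) $[\![(t_1\ t_2),ol,nl,e]\!]\to([\![t_1,ol,nl,e]\!]\ [\![t_2,ol,nl,e]\!])$; (r6) $[\![(\lambda t),ol,nl,e]\!]\to(\lambda [\![t,ol+1,nl+1,(\#1,nl+1)::e]\!])$; merging rules (m1) $[\![[\![t,ol_1,nl_1,e_1]\!],ol_2,nl_2,e_2]\!]\to[\![t,ol_1+(ol_2\mathbin{\dot- } nl_1),nl_2+(nl_1\mathbin{\dot- } ol_2),\{\!\{e_1,nl_1,ol_2,e_2\}\!\}]\!]$; (m2) $\{\!\{e_1,nl_1,0,nil\}\!\}\to e_1$; (m3) $\{\!\{nil,0,ol_2,e_2\}\!\}\to e_2$; (m4) $\{\!\{nil,nl_1,ol_2,(t,l)::e_2\}\!\}\to\{\!\{nil,nl_1-1,ol_2-1,e_2\}\!\}$ if $nl_1\ge1$; (m5) $\{\!\{(t,n)::e_1,nl_1,ol_2,(s,l)::e_2\}\!\}\to\{\!\{(t,n)::e_1,nl_1-1,ol_2-1,e_2\}\!\}$ if $nl_1>n$; (m6) $\{\!\{(t,n)::e_1,n,ol_2,(s,l)::e_2\}\!\}\to([\![t,ol_2,l,(s,l)::e_2]\!],l+(n\mathbin{\dot- } ol_2))::\{\!\{e_1,n,ol_2,(s,l)::e_2\}\!\}$. $x\rhd_{\beta_s}y$ means $y$ results from $x$ by $(\beta_s)$ at some subexpression; $\rhd_{rm}$ likewise for (r1)–(r6),(m1)–(m6). $\|t\|$ denotes the unique $\rhd_{rm}$-normal form of $t$; for terms without meta variables it is a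 de Bruijn term, i.e. a term built only from constants, $\#i$, application and abstraction. Beta reduction on de Bruijn terms: for de Bruijn terms $t$ and an infinite sequence $s_1,s_2,\dots$, define $S(c;s_1,s_2,\dots)=c$; $S(\#i;s_1,s_2,\dots)=s_i$; $S((t_1\ t_2);\bar s)=(S(t_1;\bar s)\ S(t_2;\bar s))$; $S((\lambda t);s_1,s_2,\dots)=(\lambda\, S(t;\#1,s_1',s_2',\dots))$ where $s_i'=S(s_i;\#2,\#3,\#4,\dots)$. $t\rhd_\beta s$ means $s$ results from $t$ by replacing a subterm $((\lambda t_1)\ t_2)$ with $S(t_1;t_2,\#1,\#2,\dots)$; $\rhd_\beta^*$ is its reflexive–transitive closure. -}

module Defs where

open import Data.Nat using (ℕ; zero; suc; _+_; _∸_; _≤_; _<_; _≥_; _>_)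
open import Relation.Binary.PropositionalEquality using (_≡_)
open import Relation.Binary.Construct.Closure.ReflexiveTransitive using (Star)
open import Data.Empty using (⊥)

-- CONVENTION: the de Bruijn index #i (i ≥ 1) is written  var (i ∸ 1),
-- i.e.  var k  stands for  #(k+1).

data Term (C : Set) : Set
data Env (C : Set) : Set

data Term C where
  con  : C → Term C
  var  : ℕ → Term C
  app  : Term C → Term C → Term C
  lam  : Term C → Term C
  susp : Term C → ℕ → ℕ → Env C → Term C  -- [[t, ol, nl, e]]

data Env C where
  nil  : Env C
  cons : Term C → ℕ → Env C → Env C       -- (t , l) :: e
  envc : Env C → ℕ → ℕ → Env C → Env C    -- {{e1, nl1, ol2, e2}}

module _ {C : Set} where

  len : Env C → ℕ
  len nil = 0
  len (cons t l e) = suc (len e)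
  len (envc e₁ nl₁ ol₂ e₂) = len e₁ + (len e₂ ∸ nl₁)

  lev : Env C → ℕ
  lev nil = 0
  lev (cons t l e) = l
  lev (envc e₁ nl₁ ol₂ e₂) = lev e₂ + (nl₁ ∸ ol₂)

  data WfT : Term C → Set
  data WfE : Env C → Set

  data WfT where
    con  : ∀ c → WfT (con c)
    var  : ∀ k → WfT (var k)
    app  : ∀ {t₁ t₂} → WfT t₁ → WfT t₂ → WfT (app t₁ t₂)
    lam  : ∀ {t} → WfT t → WfT (lam t)
    susp : ∀ {t ol nl e} → WfT t → WfE e → len e ≡ ol → lev e ≤ nl →
           WfT (susp t ol nl e)

  data WfE where
    nil  : WfE nil
    cons : ∀ {t l e} → WfT t → WfE e → lev e ≤ l → WfE (cons t l e)
    envc : ∀ {e₁ nl₁ ol₂ e₂} → WfE e₁ → WfE e₂ → lev e₁ ≤ nl₁ → len e₂ ≡ ol₂ →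
           WfE (envc e₁ nl₁ ol₂ e₂)

  data RootRmT : Term C → Term C → Set where
    r1 : ∀ {c ol nl e} → RootRmT (susp (con c) ol nl e) (con c)
    r2 : ∀ {i nl} → RootRmT (susp (var i) 0 nl nil) (var (i + nl))
    r3 : ∀ {ol nl t l e} →
         RootRmT (susp (var 0) ol nl (cons t l e)) (susp t 0 (nl ∸ l) nil)
    r4 : ∀ {i ol nl t l e} →
         RootRmT (susp (var (suc i)) ol nl (cons t l e)) (susp (var i) (ol ∸ 1) nl e)
    r5 : ∀ {t₁ t₂ ol nl e} →
         RootRmT (susp (app t₁ t₂) ol nl e) (app (susp t₁ ol nl e) (susp t₂ ol nl e))
    r6 : ∀ {t ol nl e} →
         RootRmT (susp (lam t) ol nl e)
                 (lam (susp t (suc ol) (suc nl) (cons (var 0) (suc nl) e)))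
    m1 : ∀ {t ol₁ nl₁ e₁ ol₂ nl₂ e₂} →
         RootRmT (susp (susp t ol₁ nl₁ e₁) ol₂ nl₂ e₂)
                 (susp t (ol₁ + (ol₂ ∸ nl₁)) (nl₂ + (nl₁ ∸ ol₂)) (envc e₁ nl₁ ol₂ e₂))

  data RootRmE : Env C → Env C → Set where
    m2 : ∀ {e₁ nl₁} → RootRmE (envc e₁ nl₁ 0 nil) e₁
    m3 : ∀ {ol₂ e₂} → RootRmE (envc nil 0 ol₂ e₂) e₂
    m4 : ∀ {nl₁ ol₂ t l e₂} → nl₁ ≥ 1 →
         RootRmE (envc nil nl₁ ol₂ (cons t l e₂)) (envc nil (nl₁ ∸ 1) (ol₂ ∸ 1) e₂)
    m5 : ∀ {t n e₁ nl₁ ol₂ s l e₂} → nl₁ > n →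
         RootRmE (envc (cons t n e₁) nl₁ ol₂ (cons s l e₂))
                 (envc (cons t n e₁) (nl₁ ∸ 1) (ol₂ ∸ 1) e₂)
    m6 : ∀ {t n e₁ ol₂ s l e₂} →
         RootRmE (envc (cons t n e₁) n ol₂ (cons s l e₂))
                 (cons (susp t ol₂ l (cons s l e₂)) (l + (n ∸ ol₂))
                       (envc e₁ n ol₂ (cons s l e₂)))

  module Closure (RT : Term C → Term C → Set) (RE : Env C → Env C → Set) where
    data StepT : Term C → Term C → Set
    data StepE : Env C → Env C → Set

    data StepT where
      root  : ∀ {t u} → RT t u → StepT t u
      appˡ  : ∀ {t t' u} → StepT t t' → StepT (app t u) (app t' u)
      appʳ  : ∀ {t u u'} → StepT u u' → StepT (app t u) (app t u')
      lam   : ∀ {t t'} → StepT t t' → StepT (lam t) (lam t')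
      suspᵗ : ∀ {t t' ol nl e} → StepT t t' → StepT (susp t ol nl e) (susp t' ol nl e)
      suspᵉ : ∀ {t ol nl e e'} → StepE e e' → StepT (susp t ol nl e) (susp t ol nl e')

    data StepE where
      root  : ∀ {e e'} → RE e e' → StepE e e'
      consᵗ : ∀ {t t' l e} → StepT t t' → StepE (cons t l e) (cons t' l e)
      consᵉ : ∀ {t l e e'} → StepE e e' → StepE (cons t l e) (cons t l e')
      envcˡ : ∀ {e₁ e₁' nl ol e₂} → StepE e₁ e₁' → StepE (envc e₁ nl ol e₂) (envc e₁' nl ol e₂)
      envcʳ : ∀ {e₁ nl ol e₂ e₂'} → StepE e₂ e₂' → StepE (envc e₁ nl ol e₂) (envc e₁ nl ol e₂')

  data RootβsT : Term C → Term C → Set where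
    βs : ∀ {t₁ t₂} → RootβsT (app (lam t₁) t₂) (susp t₁ 1 0 (cons t₂ 0 nil))

  NoEnvRule : Env C → Env C → Set
  NoEnvRule _ _ = ⊥

  _▷rm_ : Term C → Term C → Set
  _▷rm_ = Closure.StepT RootRmT RootRmE

  _▷βs_ : Term C → Term C → Set
  _▷βs_ = Closure.StepT RootβsT NoEnvRule

data DB (C : Set) : Set where
  con : C → DB C
  var : ℕ → DB C          -- var k = #(k+1)
  app : DB C → DB C → DB C
  lam : DB C → DB C

module _ {C : Set} where

  ⌜_⌝ : DB C → Term C
  ⌜ con c ⌝ = con c
  ⌜ var k ⌝ = var k
  ⌜ app t u ⌝ = app ⌜ t ⌝ ⌜ u ⌝
  ⌜ lam t ⌝ = lam ⌜ t ⌝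

  -- infinite sequences s₁, s₂, … are functions ℕ → DB C (index 0 ↦ s₁)
  _∷ₛ_ : DB C → (ℕ → DB C) → ℕ → DB C
  (s ∷ₛ σ) zero = s
  (s ∷ₛ σ) (suc j) = σ j

  ids : ℕ → DB C
  ids j = var j

  shifts : ℕ → DB C
  shifts j = var (suc j)

  -- Graph of the substitution function S(t; s₁, s₂, …) of the paper:
  -- Sub t σ u  means  S(t; σ) = u.  (Given literally as in the paper;
  -- the λ clause uses s'ᵢ = S(sᵢ; #2, #3, …).)
  data Sub : DB C → (ℕ → DB C) → DB C → Set where
    con : ∀ c σ → Sub (con c) σ (con c)
    var : ∀ k σ → Sub (var k) σ (σ k)
    app : ∀ {t₁ t₂ u₁ u₂ σ} → Sub t₁ σ u₁ → Sub t₂ σ u₂ → Sub (app t₁ t₂) σ (app u₁ u₂)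
    lam : ∀ {t u σ} (σ' : ℕ → DB C) → (∀ i → Sub (σ i) shifts (σ' i)) →
          Sub t (var 0 ∷ₛ σ') u → Sub (lam t) σ (lam u)

  data _▷β_ : DB C → DB C → Set where
    β    : ∀ {t₁ t₂ u} → Sub t₁ (t₂ ∷ₛ ids) u → app (lam t₁) t₂ ▷β u
    appˡ : ∀ {t t' u} → t ▷β t' → app t u ▷β app t' u
    appʳ : ∀ {t u u'} → u ▷β u' → app t u ▷β app t u'
    lam  : ∀ {t t'} → t ▷β t' → lam t ▷β lam t'

  _▷β*_ : DB C → DB C → Set
  _▷β*_ = Star _▷β_

  _▷rm*_ : Term C → Term C → Set
  _▷rm*_ = Star _▷rm_

-- Every suspension term denotes a de Bruijn term: [[t, ol, nl, e]] denotes the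
-- parallel substitution that the environment e, read at level nl, performs on the
-- denotation of t.  On well-formed expressions each reading and merging rule
-- preserves denotations, so ‖t‖ is the denotation of t.  A (β_s) redex denotes a
-- β-redex whose contractum is the denotation of the suspension it produces, and
-- since β-reduction is compatible with substitution, a (β_s) step anywhere inside
-- a term becomes a finite sequence of β steps between the denotations.
module Submission where

open import Defs
open import Data.Nat using (ℕ; zero; suc; _+_; _∸_; _≤_; z≤n; s≤s)
open import Data.Nat.Properties
open import Data.Product using (_×_; _,_)
open import Function using (_∘_)
open import Relation.Binary.PropositionalEquality hiding ([_])
open import Relation.Binary.Construct.Closure.ReflexiveTransitive using (ε; _◅_; _◅◅_; gmap)

module _ {C : Set} where

  ext : (ℕ → ℕ) → ℕ → ℕ
  ext ρ zero = zero
  ext ρ (suc i) = suc (ρ i)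

  ren : (ℕ → ℕ) → DB C → DB C
  ren ρ (con c) = con c
  ren ρ (var k) = var (ρ k)
  ren ρ (app t u) = app (ren ρ t) (ren ρ u)
  ren ρ (lam t) = lam (ren (ext ρ) t)

  lift : (ℕ → DB C) → ℕ → DB C
  lift σ = var 0 ∷ₛ (ren suc ∘ σ)

  sub : (ℕ → DB C) → DB C → DB C
  sub σ (con c) = con c
  sub σ (var k) = σ k
  sub σ (app t u) = app (sub σ t) (sub σ u)
  sub σ (lam t) = lam (sub (lift σ) t)

  infix 25 _[_]
  _[_] : DB C → DB C → DB C
  t [ u ] = sub (u ∷ₛ ids) t

  ren-cong : ∀ {ρ ρ′} → (∀ i → ρ i ≡ ρ′ i) → ∀ t → ren ρ t ≡ ren ρ′ t
  ren-cong h (con c) = refl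
  ren-cong h (var k) = cong DB.var (h k)
  ren-cong h (app t u) = cong₂ DB.app (ren-cong h t) (ren-cong h u)
  ren-cong h (lam t) = cong DB.lam (ren-cong h′ t)
    where h′ : ∀ i → ext _ i ≡ ext _ i
          h′ zero = refl
          h′ (suc i) = cong suc (h i)

  ren-id : ∀ {ρ} → (∀ i → ρ i ≡ i) → ∀ t → ren ρ t ≡ t
  ren-id h (con c) = refl
  ren-id h (var k) = cong DB.var (h k)
  ren-id h (app t u) = cong₂ DB.app (ren-id h t) (ren-id h u)
  ren-id {ρ} h (lam t) = cong DB.lam (ren-id h′ t)
    where h′ : ∀ i → ext ρ i ≡ i
          h′ zero = refl
          h′ (suc i) = cong suc (h i)

  ren-ren : ∀ {ρ ρ′ ρ″} → (∀ i → ρ (ρ′ i) ≡ ρ″ i) → ∀ t → ren ρ (ren ρ′ t) ≡ ren ρ″ t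
  ren-ren h (con c) = refl
  ren-ren h (var k) = cong DB.var (h k)
  ren-ren h (app t u) = cong₂ DB.app (ren-ren h t) (ren-ren h u)
  ren-ren {ρ} {ρ′} {ρ″} h (lam t) = cong DB.lam (ren-ren h′ t)
    where h′ : ∀ i → ext ρ (ext ρ′ i) ≡ ext ρ″ i
          h′ zero = refl
          h′ (suc i) = cong suc (h i)

  sub-cong : ∀ {σ σ′ : ℕ → DB C} → (∀ i → σ i ≡ σ′ i) → ∀ t → sub σ t ≡ sub σ′ t
  sub-cong h (con c) = refl
  sub-cong h (var k) = h k
  sub-cong h (app t u) = cong₂ DB.app (sub-cong h t) (sub-cong h u)
  sub-cong {σ} {σ′} h (lam t) = cong DB.lam (sub-cong h′ t)
    where h′ : ∀ i → lift σ i ≡ lift σ′ i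
          h′ zero = refl
          h′ (suc i) = cong (ren suc) (h i)

  sub-ren : ∀ {σ τ : ℕ → DB C} {ρ} → (∀ i → σ (ρ i) ≡ τ i) → ∀ t → sub σ (ren ρ t) ≡ sub τ t
  sub-ren h (con c) = refl
  sub-ren h (var k) = h k
  sub-ren h (app t u) = cong₂ DB.app (sub-ren h t) (sub-ren h u)
  sub-ren {σ} {τ} {ρ} h (lam t) = cong DB.lam (sub-ren h′ t)
    where h′ : ∀ i → lift σ (ext ρ i) ≡ lift τ i
          h′ zero = refl
          h′ (suc i) = cong (ren suc) (h i)

  ren-sub : ∀ {σ τ : ℕ → DB C} {ρ} → (∀ i → ren ρ (σ i) ≡ τ i) → ∀ t → ren ρ (sub σ t) ≡ sub τ t
  ren-sub h (con c) = refl
  ren-sub h (var k) = h k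
  ren-sub h (app t u) = cong₂ DB.app (ren-sub h t) (ren-sub h u)
  ren-sub {σ} {τ} {ρ} h (lam t) = cong DB.lam (ren-sub h′ t)
    where h′ : ∀ i → ren (ext ρ) (lift σ i) ≡ lift τ i
          h′ zero = refl
          h′ (suc i) = begin
            ren (ext ρ) (ren suc (σ i)) ≡⟨ ren-ren (λ _ → refl) (σ i) ⟩
            ren (suc ∘ ρ) (σ i)         ≡⟨ ren-ren (λ _ → refl) (σ i) ⟨
            ren suc (ren ρ (σ i))       ≡⟨ cong (ren suc) (h i) ⟩
            ren suc (τ i)               ∎
            where open ≡-Reasoning

  sub-sub : ∀ {σ τ υ : ℕ → DB C} → (∀ i → sub σ (τ i) ≡ υ i) → ∀ t → sub σ (sub τ t) ≡ sub υ t
  sub-sub h (con c) = refl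
  sub-sub h (var k) = h k
  sub-sub h (app t u) = cong₂ DB.app (sub-sub h t) (sub-sub h u)
  sub-sub {σ} {τ} {υ} h (lam t) = cong DB.lam (sub-sub h′ t)
    where h′ : ∀ i → sub (lift σ) (lift τ i) ≡ lift υ i
          h′ zero = refl
          h′ (suc i) = begin
            sub (lift σ) (ren suc (τ i)) ≡⟨ sub-ren (λ _ → refl) (τ i) ⟩
            sub (ren suc ∘ σ) (τ i)      ≡⟨ ren-sub (λ _ → refl) (τ i) ⟨
            ren suc (sub σ (τ i))        ≡⟨ cong (ren suc) (h i) ⟩
            ren suc (υ i)                ∎
            where open ≡-Reasoning

  sub-var≡ren : ∀ {σ : ℕ → DB C} {ρ} → (∀ i → σ i ≡ var (ρ i)) → ∀ t → sub σ t ≡ ren ρ t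
  sub-var≡ren h (con c) = refl
  sub-var≡ren h (var k) = h k
  sub-var≡ren h (app t u) = cong₂ DB.app (sub-var≡ren h t) (sub-var≡ren h u)
  sub-var≡ren {σ} {ρ} h (lam t) = cong DB.lam (sub-var≡ren h′ t)
    where h′ : ∀ i → lift σ i ≡ var (ext ρ i)
          h′ zero = refl
          h′ (suc i) = cong (ren suc) (h i)

  sub-ids : ∀ t → sub ids t ≡ t
  sub-ids t = trans (sub-var≡ren (λ _ → refl) t) (ren-id (λ _ → refl) t)

  sub-[] : ∀ σ t u → sub σ (t [ u ]) ≡ sub (lift σ) t [ sub σ u ]
  sub-[] σ t u = trans (sub-sub (λ _ → refl) t) (sym (sub-sub lift-[] t))
    where lift-[] : ∀ i → sub (sub σ u ∷ₛ ids) (lift σ i) ≡ sub σ ((u ∷ₛ ids) i)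
          lift-[] zero = refl
          lift-[] (suc i) = trans (sub-ren (λ _ → refl) (σ i)) (sub-ids (σ i))

  Sub-ren : ∀ {σ ρ} → (∀ i → σ i ≡ var (ρ i)) → ∀ t → Sub t σ (ren ρ t)
  Sub-ren {σ} h (con c) = con c σ
  Sub-ren {σ} h (var k) = subst (Sub (var k) σ) (h k) (var k σ)
  Sub-ren h (app t u) = app (Sub-ren h t) (Sub-ren h u)
  Sub-ren {σ} {ρ} h (lam t) = lam (DB.var ∘ suc ∘ ρ) shifted (Sub-ren h′ t)
    where shifted : ∀ i → Sub (σ i) shifts (var (suc (ρ i)))
          shifted i = subst (λ v → Sub v shifts (var (suc (ρ i)))) (sym (h i)) (var (ρ i) shifts)
          h′ : ∀ i → (var 0 ∷ₛ (DB.var ∘ suc ∘ ρ)) i ≡ var (ext ρ i)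
          h′ zero = refl
          h′ (suc i) = refl

  Sub-sub : ∀ t σ → Sub t σ (sub σ t)
  Sub-sub (con c) σ = con c σ
  Sub-sub (var k) σ = var k σ
  Sub-sub (app t u) σ = app (Sub-sub t σ) (Sub-sub u σ)
  Sub-sub (lam t) σ = lam (ren suc ∘ σ) (λ i → Sub-ren (λ _ → refl) (σ i)) (Sub-sub t (lift σ))

  Sub⇒≡sub : ∀ {t σ u} → Sub t σ u → u ≡ sub σ t
  Sub⇒≡sub (con c σ) = refl
  Sub⇒≡sub (var k σ) = refl
  Sub⇒≡sub (app r₁ r₂) = cong₂ DB.app (Sub⇒≡sub r₁) (Sub⇒≡sub r₂)
  Sub⇒≡sub {lam t} {σ} (lam σ′ hσ′ r) = cong DB.lam (trans (Sub⇒≡sub r) (sub-cong h t))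
    where h : ∀ i → (var 0 ∷ₛ σ′) i ≡ lift σ i
          h zero = refl
          h (suc i) = trans (Sub⇒≡sub (hσ′ i)) (sub-var≡ren (λ _ → refl) (σ i))

  β-contract : ∀ t u → app (lam t) u ▷β t [ u ]
  β-contract t u = β (Sub-sub t (u ∷ₛ ids))

  app-▷β*ˡ : ∀ {t t′ u : DB C} → t ▷β* t′ → app t u ▷β* app t′ u
  app-▷β*ˡ {u = u} = gmap (λ x → app x u) appˡ

  app-▷β*ʳ : ∀ {t u u′ : DB C} → u ▷β* u′ → app t u ▷β* app t u′
  app-▷β*ʳ {t = t} = gmap (app t) appʳ

  lam-▷β* : ∀ {t t′ : DB C} → t ▷β* t′ → lam t ▷β* lam t′
  lam-▷β* = gmap DB.lam lam

  sub-▷β : ∀ σ {t t′} → t ▷β t′ → sub σ t ▷β sub σ t′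
  sub-▷β σ (β {t₁} {t₂} r) =
    subst (app (lam (sub (lift σ) t₁)) (sub σ t₂) ▷β_)
          (trans (sym (sub-[] σ t₁ t₂)) (cong (sub σ) (sym (Sub⇒≡sub r))))
          (β-contract (sub (lift σ) t₁) (sub σ t₂))
  sub-▷β σ (appˡ r) = appˡ (sub-▷β σ r)
  sub-▷β σ (appʳ r) = appʳ (sub-▷β σ r)
  sub-▷β σ (lam r) = lam (sub-▷β (lift σ) r)

  sub-▷β* : ∀ σ {t t′} → t ▷β* t′ → sub σ t ▷β* sub σ t′
  sub-▷β* σ = gmap (sub σ) (sub-▷β σ)

  ren-▷β* : ∀ ρ {t t′} → t ▷β* t′ → ren ρ t ▷β* ren ρ t′
  ren-▷β* ρ {t} {t′} r = subst₂ _▷β*_ (sub-var≡ren (λ _ → refl) t) (sub-var≡ren (λ _ → refl) t′)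
                                      (sub-▷β* (DB.var ∘ ρ) r)

  sub-cong-▷β* : ∀ {σ σ′ : ℕ → DB C} → (∀ i → σ i ▷β* σ′ i) → ∀ t → sub σ t ▷β* sub σ′ t
  sub-cong-▷β* h (con c) = ε
  sub-cong-▷β* h (var k) = h k
  sub-cong-▷β* h (app t u) = app-▷β*ˡ (sub-cong-▷β* h t) ◅◅ app-▷β*ʳ (sub-cong-▷β* h u)
  sub-cong-▷β* {σ} {σ′} h (lam t) = lam-▷β* (sub-cong-▷β* h′ t)
    where h′ : ∀ i → lift σ i ▷β* lift σ′ i
          h′ zero = ε
          h′ (suc i) = ren-▷β* suc (h i)

  -- ⟦ e ⟧ₑ nl is the substitution performed by [[_, len e, nl, e]].
  -- In {{e₁, nl₁, ol₂, e₂}} the terms of e₁ live at level nl₁ and are then read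
  -- through e₂, whose level sits nl₁ ∸ ol₂ below that of the whole environment.
  ⟦_⟧ : Term C → DB C
  ⟦_⟧ₑ : Env C → ℕ → ℕ → DB C
  ⟦ con c ⟧ = con c
  ⟦ var k ⟧ = var k
  ⟦ app t u ⟧ = app ⟦ t ⟧ ⟦ u ⟧
  ⟦ lam t ⟧ = lam ⟦ t ⟧
  ⟦ susp t ol nl e ⟧ = sub (⟦ e ⟧ₑ nl) ⟦ t ⟧
  ⟦ nil ⟧ₑ nl i = var (i + nl)
  ⟦ cons t l e ⟧ₑ nl zero = ren (_+ (nl ∸ l)) ⟦ t ⟧
  ⟦ cons t l e ⟧ₑ nl (suc i) = ⟦ e ⟧ₑ nl i
  ⟦ envc e₁ nl₁ ol₂ e₂ ⟧ₑ nl i = sub (⟦ e₂ ⟧ₑ (nl ∸ (nl₁ ∸ ol₂))) (⟦ e₁ ⟧ₑ nl₁ i)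

  ⟦⌜⌝⟧ : ∀ a → ⟦ ⌜ a ⌝ ⟧ ≡ a
  ⟦⌜⌝⟧ (con c) = refl
  ⟦⌜⌝⟧ (var k) = refl
  ⟦⌜⌝⟧ (app a b) = cong₂ DB.app (⟦⌜⌝⟧ a) (⟦⌜⌝⟧ b)
  ⟦⌜⌝⟧ (lam a) = cong DB.lam (⟦⌜⌝⟧ a)

  ⟦⟧ₑ-+ : ∀ {e} → WfE e → ∀ m → lev e ≤ m → ∀ d i → ⟦ e ⟧ₑ (m + d) i ≡ ren (_+ d) (⟦ e ⟧ₑ m i)
  ⟦⟧ₑ-+ nil m _ d i = cong DB.var (sym (+-assoc i m d))
  ⟦⟧ₑ-+ (cons {t} {l} _ _ _) m l≤m d zero = sym (ren-ren +-shift ⟦ t ⟧)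
    where +-shift : ∀ j → j + (m ∸ l) + d ≡ j + (m + d ∸ l)
          +-shift j = trans (+-assoc j _ d) (cong (j +_) (sym (+-∸-comm d l≤m)))
  ⟦⟧ₑ-+ (cons _ we le) m l≤m d (suc i) = ⟦⟧ₑ-+ we m (≤-trans le l≤m) d i
  ⟦⟧ₑ-+ (envc {e₁} {nl₁} {ol₂} {e₂} _ we₂ _ _) m lev≤m d i
    rewrite +-∸-comm d (≤-trans (m≤n+m (nl₁ ∸ ol₂) (lev e₂)) lev≤m)
    = sym (ren-sub (λ j → sym (⟦⟧ₑ-+ we₂ (m ∸ (nl₁ ∸ ol₂)) (m+n≤o⇒m≤o∸n (lev e₂) lev≤m) d j))
                   (⟦ e₁ ⟧ₑ nl₁ i))

  ⟦⟧ₑ-suc : ∀ {e} → WfE e → ∀ m → lev e ≤ m → ∀ i → ⟦ e ⟧ₑ (suc m) i ≡ ren suc (⟦ e ⟧ₑ m i)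
  ⟦⟧ₑ-suc {e} we m lev≤m i = begin
    ⟦ e ⟧ₑ (suc m) i          ≡⟨ cong (λ x → ⟦ e ⟧ₑ x i) (+-comm 1 m) ⟩
    ⟦ e ⟧ₑ (m + 1) i          ≡⟨ ⟦⟧ₑ-+ we m lev≤m 1 i ⟩
    ren (_+ 1) (⟦ e ⟧ₑ m i)   ≡⟨ ren-cong (λ j → +-comm j 1) (⟦ e ⟧ₑ m i) ⟩
    ren suc (⟦ e ⟧ₑ m i)      ∎
    where open ≡-Reasoning

  WfReduct : Env C → Env C → Set
  WfReduct e e′ = WfE e′ × len e′ ≡ len e × lev e′ ≤ lev e

  RootRmT-wf : ∀ {t t′ : Term C} → RootRmT t t′ → WfT t → WfT t′
  RootRmT-wf r1 _ = con _
  RootRmT-wf r2 _ = var _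
  RootRmT-wf r3 (susp _ (cons wt _ _) _ _) = susp wt nil refl z≤n
  RootRmT-wf r4 (susp _ (cons _ we le) eq lev≤nl) = susp (var _) we (cong (_∸ 1) eq) (≤-trans le lev≤nl)
  RootRmT-wf r5 (susp (app w₁ w₂) we eq le) = app (susp w₁ we eq le) (susp w₂ we eq le)
  RootRmT-wf r6 (susp (lam w) we eq le) = lam (susp w (cons (var 0) we (m≤n⇒m≤1+n le)) (cong suc eq) ≤-refl)
  RootRmT-wf (m1 {nl₁ = nl₁} {ol₂ = ol₂}) (susp (susp w we₁ refl le₁) we₂ refl le₂) =
    susp w (envc we₁ we₂ le₁ refl) refl (+-monoˡ-≤ (nl₁ ∸ ol₂) le₂)

  RootRmE-wf : ∀ {e e′ : Env C} → RootRmE e e′ → WfE e → WfReduct e e′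
  RootRmE-wf (m2 {e₁} {nl₁}) (envc we₁ _ le₁ _) =
    we₁ , sym (trans (cong (len e₁ +_) (0∸n≡0 nl₁)) (+-identityʳ _)) , le₁
  RootRmE-wf (m3 {ol₂} {e₂}) (envc _ we₂ _ _) = we₂ , refl , m≤m+n (lev e₂) (0 ∸ ol₂)
  RootRmE-wf (m4 {suc p} {e₂ = e₂} (s≤s z≤n)) (envc nil (cons _ we₂ le) _ refl) =
    envc nil we₂ z≤n refl , refl , +-monoˡ-≤ (p ∸ len e₂) le
  RootRmE-wf (m5 {nl₁ = suc p} {e₂ = e₂} (s≤s n≤p)) (envc wc (cons _ we₂ le) _ refl) =
    envc wc we₂ n≤p refl , refl , +-monoˡ-≤ (p ∸ len e₂) le
  RootRmE-wf m6 (envc (cons wt we₁ le₁) wE₂ _ refl) =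
    cons (susp wt wE₂ refl ≤-refl) (envc we₁ wE₂ le₁ refl) ≤-refl , refl , ≤-refl

  RootRmT-⟦⟧ : ∀ {t t′} → RootRmT t t′ → WfT t → ⟦ t ⟧ ≡ ⟦ t′ ⟧
  RootRmT-⟦⟧ r1 _ = refl
  RootRmT-⟦⟧ r2 _ = refl
  RootRmT-⟦⟧ (r3 {t = t}) _ = sym (sub-var≡ren (λ _ → refl) ⟦ t ⟧)
  RootRmT-⟦⟧ r4 _ = refl
  RootRmT-⟦⟧ r5 _ = refl
  RootRmT-⟦⟧ (r6 {t} {nl = nl} {e = e}) (susp _ we _ le) = cong DB.lam (sub-cong h ⟦ t ⟧)
    where h : ∀ i → lift (⟦ e ⟧ₑ nl) i ≡ ⟦ cons (var 0) (suc nl) e ⟧ₑ (suc nl) i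
          h zero = cong DB.var (sym (n∸n≡0 nl))
          h (suc i) = sym (⟦⟧ₑ-suc we nl le i)
  RootRmT-⟦⟧ (m1 {t} {nl₁ = nl₁} {e₁} {ol₂} {nl₂} {e₂}) _ = sub-sub h ⟦ t ⟧
    where h : ∀ i → sub (⟦ e₂ ⟧ₑ nl₂) (⟦ e₁ ⟧ₑ nl₁ i)
                  ≡ sub (⟦ e₂ ⟧ₑ (nl₂ + (nl₁ ∸ ol₂) ∸ (nl₁ ∸ ol₂))) (⟦ e₁ ⟧ₑ nl₁ i)
          h i = cong (λ x → sub (⟦ e₂ ⟧ₑ x) (⟦ e₁ ⟧ₑ nl₁ i)) (sym (m+n∸n≡m nl₂ (nl₁ ∸ ol₂)))

  m6-⟦⟧ₑ : ∀ {t n e₁ ol₂ s l e₂} → WfE (cons s l e₂) → ∀ nl → l + (n ∸ ol₂) ≤ nl →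
           ⟦ envc (cons t n e₁) n ol₂ (cons s l e₂) ⟧ₑ nl 0
           ≡ ⟦ cons (susp t ol₂ l (cons s l e₂)) (l + (n ∸ ol₂)) (envc e₁ n ol₂ (cons s l e₂)) ⟧ₑ nl 0
  m6-⟦⟧ₑ {t} {n} {ol₂ = ol₂} {s} {l} {e₂} wE₂ nl lev≤nl = begin
    sub (⟦ E₂ ⟧ₑ (nl ∸ k)) (ren (_+ (n ∸ n)) ⟦ t ⟧) ≡⟨ sub-ren (λ j → cong (⟦ E₂ ⟧ₑ _) (+0 j)) ⟦ t ⟧ ⟩
    sub (⟦ E₂ ⟧ₑ (nl ∸ k)) ⟦ t ⟧                    ≡⟨ sub-cong shift ⟦ t ⟧ ⟩
    sub (ren (_+ d) ∘ ⟦ E₂ ⟧ₑ l) ⟦ t ⟧               ≡⟨ ren-sub (λ _ → refl) ⟦ t ⟧ ⟨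
    ren (_+ d) (sub (⟦ E₂ ⟧ₑ l) ⟦ t ⟧)               ∎
    where
      open ≡-Reasoning
      E₂ = cons s l e₂
      k = n ∸ ol₂
      d = nl ∸ (l + k)
      +0 : ∀ j → j + (n ∸ n) ≡ j
      +0 j = trans (cong (j +_) (n∸n≡0 n)) (+-identityʳ j)
      nl∸k≡l+d : nl ∸ k ≡ l + d
      nl∸k≡l+d = begin
        nl ∸ k           ≡⟨ m+[n∸m]≡n (m+n≤o⇒m≤o∸n l lev≤nl) ⟨
        l + (nl ∸ k ∸ l) ≡⟨ cong (l +_) (∸-+-assoc nl k l) ⟩
        l + (nl ∸ (k + l)) ≡⟨ cong (λ x → l + (nl ∸ x)) (+-comm k l) ⟩
        l + d            ∎
      shift : ∀ j → ⟦ E₂ ⟧ₑ (nl ∸ k) j ≡ ren (_+ d) (⟦ E₂ ⟧ₑ l j)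
      shift j = trans (cong (λ x → ⟦ E₂ ⟧ₑ x j) nl∸k≡l+d) (⟦⟧ₑ-+ wE₂ l ≤-refl d j)

  RootRmE-⟦⟧ₑ : ∀ {e e′} → RootRmE e e′ → WfE e → ∀ nl → lev e ≤ nl → ∀ i → ⟦ e ⟧ₑ nl i ≡ ⟦ e′ ⟧ₑ nl i
  RootRmE-⟦⟧ₑ (m2 {e₁} {nl₁}) (envc we₁ _ le₁ _) nl nl₁≤nl i = begin
    sub (DB.var ∘ (_+ (nl ∸ nl₁))) (⟦ e₁ ⟧ₑ nl₁ i) ≡⟨ sub-var≡ren (λ _ → refl) (⟦ e₁ ⟧ₑ nl₁ i) ⟩
    ren (_+ (nl ∸ nl₁)) (⟦ e₁ ⟧ₑ nl₁ i)        ≡⟨ ⟦⟧ₑ-+ we₁ nl₁ le₁ (nl ∸ nl₁) i ⟨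
    ⟦ e₁ ⟧ₑ (nl₁ + (nl ∸ nl₁)) i               ≡⟨ cong (λ x → ⟦ e₁ ⟧ₑ x i) (m+[n∸m]≡n nl₁≤nl) ⟩
    ⟦ e₁ ⟧ₑ nl i                               ∎
    where open ≡-Reasoning
  RootRmE-⟦⟧ₑ (m3 {ol₂} {e₂}) _ nl _ i = cong₂ (λ a b → ⟦ e₂ ⟧ₑ (nl ∸ a) b) (0∸n≡0 ol₂) (+-identityʳ i)
  RootRmE-⟦⟧ₑ (m4 {suc p} {t = t} {l} {e₂} _) (envc _ _ _ refl) nl _ i =
    cong (⟦ cons t l e₂ ⟧ₑ (nl ∸ (p ∸ len e₂))) (+-suc i p)
  RootRmE-⟦⟧ₑ (m5 {t} {n} {e₁} {suc p} {s = s} {l} {e₂} (s≤s n≤p)) (envc wc _ _ refl) nl _ i =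
    trans (cong (sub (⟦ cons s l e₂ ⟧ₑ (nl ∸ (p ∸ len e₂)))) (⟦⟧ₑ-suc wc p n≤p i))
          (sub-ren (λ _ → refl) (⟦ cons t n e₁ ⟧ₑ p i))
  RootRmE-⟦⟧ₑ (m6 {t} {n} {e₁} {ol₂}) (envc (cons _ _ _) wE₂ _ refl) nl lev≤nl zero =
    m6-⟦⟧ₑ {t} {n} {e₁} {ol₂} wE₂ nl lev≤nl
  RootRmE-⟦⟧ₑ m6 (envc (cons _ _ _) _ _ refl) nl _ (suc i) = refl

  module RM = Closure {C} RootRmT RootRmE

  StepT-wf : ∀ {t t′} → RM.StepT t t′ → WfT t → WfT t′
  StepE-wf : ∀ {e e′} → RM.StepE e e′ → WfE e → WfReduct e e′
  StepT-wf (RM.root r) w = RootRmT-wf r w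
  StepT-wf (RM.appˡ r) (app w₁ w₂) = app (StepT-wf r w₁) w₂
  StepT-wf (RM.appʳ r) (app w₁ w₂) = app w₁ (StepT-wf r w₂)
  StepT-wf (RM.lam r) (lam w) = lam (StepT-wf r w)
  StepT-wf (RM.suspᵗ r) (susp w we eq le) = susp (StepT-wf r w) we eq le
  StepT-wf (RM.suspᵉ r) (susp w we eq le) with StepE-wf r we
  ... | we′ , eq′ , le′ = susp w we′ (trans eq′ eq) (≤-trans le′ le)
  StepE-wf (RM.root r) w = RootRmE-wf r w
  StepE-wf (RM.consᵗ r) (cons wt we le) = cons (StepT-wf r wt) we le , refl , ≤-refl
  StepE-wf (RM.consᵉ r) (cons wt we le) with StepE-wf r we
  ... | we′ , eq , le′ = cons wt we′ (≤-trans le′ le) , cong suc eq , ≤-refl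
  StepE-wf (RM.envcˡ {nl = nl} {e₂ = e₂} r) (envc we₁ we₂ le₁ eq₂) with StepE-wf r we₁
  ... | we₁′ , eq , le′ = envc we₁′ we₂ (≤-trans le′ le₁) eq₂ , cong (_+ (len e₂ ∸ nl)) eq , ≤-refl
  StepE-wf (RM.envcʳ {e₁} {nl} {ol} r) (envc we₁ we₂ le₁ eq₂) with StepE-wf r we₂
  ... | we₂′ , eq , le′ = envc we₁ we₂′ le₁ (trans eq eq₂) , cong (λ x → len e₁ + (x ∸ nl)) eq ,
                          +-monoˡ-≤ (nl ∸ ol) le′

  StepT-⟦⟧ : ∀ {t t′} → RM.StepT t t′ → WfT t → ⟦ t ⟧ ≡ ⟦ t′ ⟧
  StepE-⟦⟧ₑ : ∀ {e e′} → RM.StepE e e′ → WfE e → ∀ nl → lev e ≤ nl → ∀ i → ⟦ e ⟧ₑ nl i ≡ ⟦ e′ ⟧ₑ nl i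
  StepT-⟦⟧ (RM.root r) w = RootRmT-⟦⟧ r w
  StepT-⟦⟧ (RM.appˡ {u = u} r) (app w _) = cong (λ x → app x ⟦ u ⟧) (StepT-⟦⟧ r w)
  StepT-⟦⟧ (RM.appʳ {t = t} r) (app _ w) = cong (app ⟦ t ⟧) (StepT-⟦⟧ r w)
  StepT-⟦⟧ (RM.lam r) (lam w) = cong DB.lam (StepT-⟦⟧ r w)
  StepT-⟦⟧ (RM.suspᵗ {nl = nl} {e = e} r) (susp w _ _ _) = cong (sub (⟦ e ⟧ₑ nl)) (StepT-⟦⟧ r w)
  StepT-⟦⟧ (RM.suspᵉ {t} {nl = nl} r) (susp _ we _ le) = sub-cong (StepE-⟦⟧ₑ r we nl le) ⟦ t ⟧
  StepE-⟦⟧ₑ (RM.root r) w nl le i = RootRmE-⟦⟧ₑ r w nl le i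
  StepE-⟦⟧ₑ (RM.consᵗ {l = l} r) (cons wt _ _) nl _ zero = cong (ren (_+ (nl ∸ l))) (StepT-⟦⟧ r wt)
  StepE-⟦⟧ₑ (RM.consᵗ r) _ nl _ (suc i) = refl
  StepE-⟦⟧ₑ (RM.consᵉ r) _ nl _ zero = refl
  StepE-⟦⟧ₑ (RM.consᵉ r) (cons _ we le) nl l≤nl (suc i) = StepE-⟦⟧ₑ r we nl (≤-trans le l≤nl) i
  StepE-⟦⟧ₑ (RM.envcˡ {nl = nl₁} {ol} {e₂} r) (envc we₁ _ le₁ _) nl _ i =
    cong (sub (⟦ e₂ ⟧ₑ (nl ∸ (nl₁ ∸ ol)))) (StepE-⟦⟧ₑ r we₁ nl₁ le₁ i)
  StepE-⟦⟧ₑ (RM.envcʳ {e₁} {nl₁} {ol} {e₂} r) (envc _ we₂ _ _) nl lev≤nl i =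
    sub-cong (StepE-⟦⟧ₑ r we₂ (nl ∸ (nl₁ ∸ ol)) (m+n≤o⇒m≤o∸n (lev e₂) lev≤nl)) (⟦ e₁ ⟧ₑ nl₁ i)

  ▷rm*-⟦⟧ : ∀ {t u} → WfT t → t ▷rm* u → ⟦ t ⟧ ≡ ⟦ u ⟧
  ▷rm*-⟦⟧ w ε = refl
  ▷rm*-⟦⟧ w (r ◅ rs) = trans (StepT-⟦⟧ r w) (▷rm*-⟦⟧ (StepT-wf r w) rs)

  module BS = Closure {C} RootβsT NoEnvRule

  βs-⟦⟧ : ∀ {t t′} → BS.StepT t t′ → ⟦ t ⟧ ▷β* ⟦ t′ ⟧
  βs-⟦⟧ₑ : ∀ {e e′} → BS.StepE e e′ → ∀ nl i → ⟦ e ⟧ₑ nl i ▷β* ⟦ e′ ⟧ₑ nl i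
  βs-⟦⟧ (BS.root (βs {t₁} {t₂})) =
    subst (app (lam ⟦ t₁ ⟧) ⟦ t₂ ⟧ ▷β*_) (sub-cong h ⟦ t₁ ⟧) (β-contract ⟦ t₁ ⟧ ⟦ t₂ ⟧ ◅ ε)
    where h : ∀ i → (⟦ t₂ ⟧ ∷ₛ ids) i ≡ ⟦ cons t₂ 0 nil ⟧ₑ 0 i
          h zero = sym (ren-id +-identityʳ ⟦ t₂ ⟧)
          h (suc i) = cong DB.var (sym (+-identityʳ i))
  βs-⟦⟧ (BS.appˡ r) = app-▷β*ˡ (βs-⟦⟧ r)
  βs-⟦⟧ (BS.appʳ r) = app-▷β*ʳ (βs-⟦⟧ r)
  βs-⟦⟧ (BS.lam r) = lam-▷β* (βs-⟦⟧ r)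
  βs-⟦⟧ (BS.suspᵗ {nl = nl} {e = e} r) = sub-▷β* (⟦ e ⟧ₑ nl) (βs-⟦⟧ r)
  βs-⟦⟧ (BS.suspᵉ {t} {nl = nl} r) = sub-cong-▷β* (βs-⟦⟧ₑ r nl) ⟦ t ⟧
  βs-⟦⟧ₑ (BS.root ())
  βs-⟦⟧ₑ (BS.consᵗ {l = l} r) nl zero = ren-▷β* (_+ (nl ∸ l)) (βs-⟦⟧ r)
  βs-⟦⟧ₑ (BS.consᵗ r) nl (suc i) = ε
  βs-⟦⟧ₑ (BS.consᵉ r) nl zero = ε
  βs-⟦⟧ₑ (BS.consᵉ r) nl (suc i) = βs-⟦⟧ₑ r nl i
  βs-⟦⟧ₑ (BS.envcˡ {nl = nl₁} {ol} {e₂} r) nl i = sub-▷β* (⟦ e₂ ⟧ₑ (nl ∸ (nl₁ ∸ ol))) (βs-⟦⟧ₑ r nl₁ i)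
  βs-⟦⟧ₑ (BS.envcʳ {e₁} {nl₁} {ol} r) nl i = sub-cong-▷β* (βs-⟦⟧ₑ r (nl ∸ (nl₁ ∸ ol))) (⟦ e₁ ⟧ₑ nl₁ i)

theorem3p20 : ∀ {C : Set} (t s : Term C) → WfT t → WfT s → t ▷βs s →
                (a b : DB C) → t ▷rm* ⌜ a ⌝ → s ▷rm* ⌜ b ⌝ → a ▷β* b
theorem3p20 t s wt ws t▷s a b t↠a s↠b =
  subst₂ _▷β*_ (trans (▷rm*-⟦⟧ wt t↠a) (⟦⌜⌝⟧ a)) (trans (▷rm*-⟦⟧ ws s↠b) (⟦⌜⌝⟧ b)) (βs-⟦⟧ t▷s)
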